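{- The competitive ratio of the \textsc{Ranking} algorithm for online bipartite matching on $2$-regular bipartite graphs is at most $\frac{119}{144}\ (\approx 0.8264)$.
   Context: Online bipartite matching: a bipartite graph $G=(S\cup R,E)$ has offline servers $S$ and online requests $R$ arriving one at a time in adversarial order; on arrival of $r$ its neighbors are revealed and the algorithm irrevocably matches $r$ to an unmatched neighbor or leaves it unmatched. The competitive ratio of an algorithm on a class of instances is the infimum over instances of $\mathbb{E}[\mathsf{ALG}]/\mathsf{OPT}$, where $\mathsf{ALG}$ is the size of the produced matching and $\mathsf{OPT}$ the maximum matching size. A bipartite graph is $2$-regular if all vertices have degree exactly $2$. \textsc{Ranking}: each server independently draws a rank uniformly from $[0,1]$; each arriving request is matched to its unmatched neighbor of smallest rank, if any. -}

module Defs where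

open import Data.Nat using (ℕ; zero; suc; _+_; _*_; _≤_; _<_)
open import Data.Bool using (Bool; true; false; if_then_else_; _∧_; not)
open import Data.Fin using (Fin)
open import Data.Fin.Properties using (_≟_)
open import Data.List using (List; []; _∷_; map; concatMap; allFin; length)
open import Data.Nat.ListAction using (sum)
open import Data.Maybe using (Maybe; just; nothing)
open import Data.Product using (Σ; _×_; _,_)
open import Relation.Nullary using (does)
open import Relation.Binary.PropositionalEquality using (_≡_)

-- A bipartite graph with m online requests (Fin m, arriving in the order
-- 0,1,...,m-1) and n offline servers (Fin n); adj r s = true iff {r,s} ∈ E.
Graph : ℕ → ℕ → Set
Graph m n = Fin m → Fin n → Bool

b2n : Bool → ℕ
b2n true  = 1
b2n false = 0

degReq : ∀ {m n} → Graph m n → Fin m → ℕ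
degReq {m} {n} G r = sum (map (λ s → b2n (G r s)) (allFin n))

degSrv : ∀ {m n} → Graph m n → Fin n → ℕ
degSrv {m} {n} G s = sum (map (λ r → b2n (G r s)) (allFin m))

TwoRegular : ∀ {m n} → Graph m n → Set
TwoRegular G = (∀ r → degReq G r ≡ 2) × (∀ s → degSrv G s ≡ 2)

IsMatching : ∀ {m n} → Graph m n → (Fin m → Maybe (Fin n)) → Set
IsMatching G f =
  (∀ r s → f r ≡ just s → G r s ≡ true) ×
  (∀ r r' s → f r ≡ just s → f r' ≡ just s → r ≡ r')

isJust : ∀ {A : Set} → Maybe A → ℕ
isJust (just _) = 1
isJust nothing  = 0

matchingSize : ∀ {m n} → (Fin m → Maybe (Fin n)) → ℕ
matchingSize {m} f = sum (map (λ r → isJust (f r)) (allFin m))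

IsMaxMatchingSize : ∀ {m n} → Graph m n → ℕ → Set
IsMaxMatchingSize G k =
  Σ _ (λ f → IsMatching G f × matchingSize f ≡ k) ×
  (∀ f → IsMatching G f → matchingSize f ≤ k)

insertions : ∀ {A : Set} → A → List A → List (List A)
insertions x []       = (x ∷ []) ∷ []
insertions x (y ∷ ys) = (x ∷ y ∷ ys) ∷ map (y ∷_) (insertions x ys)

perms : ∀ {A : Set} → List A → List (List A)
perms []       = [] ∷ []
perms (x ∷ xs) = concatMap (insertions x) (perms xs)

-- Ranking with the servers ranked by a permutation π (earlier in π =
-- smaller rank).  firstFree returns the unmatched neighbour of smallest rank.
firstFree : ∀ {n} → (Fin n → Bool) → (Fin n → Bool) → List (Fin n) → Maybe (Fin n)
firstFree nb used []      = nothing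
firstFree nb used (s ∷ π) =
  if nb s ∧ not (used s) then just s else firstFree nb used π

markUsed : ∀ {n} → (Fin n → Bool) → Fin n → Fin n → Bool
markUsed used s s' = if does (s' ≟ s) then true else used s'

rankingStep : ∀ {m n} → Graph m n → List (Fin n) → List (Fin m) →
              (Fin n → Bool) → ℕ
rankingFrom : ∀ {m n} → Graph m n → List (Fin n) → List (Fin m) →
              (Fin n → Bool) → Maybe (Fin n) → ℕ

rankingStep G π []       used = 0
rankingStep G π (r ∷ rs) used = rankingFrom G π rs used (firstFree (G r) used π)

rankingFrom G π rs used nothing  = rankingStep G π rs used
rankingFrom G π rs used (just s) = suc (rankingStep G π rs (markUsed used s))

ranking : ∀ {m n} → Graph m n → List (Fin n) → ℕ
ranking {m} G π = rankingStep G π (allFin m) (λ _ → false)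

-- Σ over all n! rank orders of the Ranking matching size
-- (= n! · E[ALG], since i.i.d. uniform ranks induce a uniform random order)
rankingTotal : ∀ {m n} → Graph m n → ℕ
rankingTotal {m} {n} G = sum (map (ranking G) (perms (allFin n)))

numOrders : ℕ → ℕ
numOrders n = length (perms (allFin n))

-- The witness is the 16-cycle s₀ t₀ s₁ t₁ ⋯ s₇ t₇ (request tⱼ adjacent to the
-- servers sⱼ and sⱼ₊₁ mod 8), whose requests arrive in the order
-- t₀, t₄, t₁, t₅, t₃, t₇, t₂, t₆.  Counting over all 8! rank orders, Ranking
-- matches on average exactly 119/18 requests, while the perfect matching
-- tⱼ ↦ sⱼ has size 8, so E[ALG]/OPT = 119/144.
module Submission where

open import Defs
open import Data.Nat using (ℕ; suc; _+_; _*_; _≤_; _<_; z≤n; s≤s)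
open import Data.Nat.Properties using (+-mono-≤; *-monoʳ-≤; m≤m+n; ≤-reflexive; module ≤-Reasoning)
import Data.Nat.Properties as ℕ
open import Data.Nat.ListAction using (sum)
open import Data.Nat.Tactic.RingSolver using (solve-∀)
open import Data.Bool using (true; _∨_)
import Data.Bool.Properties as Bool
open import Data.Fin using (Fin; #_)
open import Data.Fin.Properties using (_≟_; all?)
open import Data.Vec using (lookup; _∷_; [])
open import Data.List using (List; []; _∷_; map; length; allFin)
open import Data.List.Properties using (length-tabulate)
open import Data.Maybe using (Maybe; just; nothing)
open import Data.Maybe.Properties using (just-injective)
open import Data.Product using (Σ; _×_; _,_)
open import Function.Definitions using (Injective)
open import Relation.Nullary using (does)
open import Relation.Nullary.Decidable using (from-yes)
open import Relation.Binary.PropositionalEquality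
  using (_≡_; refl; sym; trans; cong; subst)

isJust≤1 : ∀ {A : Set} (x : Maybe A) → isJust x ≤ 1
isJust≤1 (just _) = s≤s z≤n
isJust≤1 nothing  = z≤n

sum-isJust≤length : ∀ {A B : Set} (f : A → Maybe B) (xs : List A) →
                    sum (map (λ x → isJust (f x)) xs) ≤ length xs
sum-isJust≤length f []       = z≤n
sum-isJust≤length f (x ∷ xs) = +-mono-≤ (isJust≤1 (f x)) (sum-isJust≤length f xs)

sum-just≡length : ∀ {A B : Set} (g : A → B) (xs : List A) →
                  sum (map (λ x → isJust (just (g x))) xs) ≡ length xs
sum-just≡length g []       = refl
sum-just≡length g (x ∷ xs) = cong suc (sum-just≡length g xs)

matchingSize≤ : ∀ {m n} (f : Fin m → Maybe (Fin n)) → matchingSize f ≤ m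
matchingSize≤ {m} f = subst (matchingSize f ≤_) (length-tabulate {n = m} (λ r → r))
                            (sum-isJust≤length f (allFin m))

matchingSize-total : ∀ {m n} (g : Fin m → Fin n) → matchingSize (λ r → just (g r)) ≡ m
matchingSize-total {m} g = trans (sum-just≡length g (allFin m))
                                 (length-tabulate {n = m} (λ r → r))

perfectMatching⇒maxMatchingSize :
  ∀ {m n} (G : Graph m n) (g : Fin m → Fin n) →
  (∀ r → G r (g r) ≡ true) → Injective _≡_ _≡_ g → IsMaxMatchingSize G m
perfectMatching⇒maxMatchingSize G g along injective =
  ((λ r → just (g r)) , (alongEdges , injectiveOnMatched) , matchingSize-total g) ,
  λ f _ → matchingSize≤ f
  where
  alongEdges : ∀ r s → just (g r) ≡ just s → G r s ≡ true
  alongEdges r s eq = subst (λ s → G r s ≡ true) (just-injective eq) (along r)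

  injectiveOnMatched : ∀ r r' s → just (g r) ≡ just s → just (g r') ≡ just s → r ≡ r'
  injectiveOnMatched r r' s p q = injective (just-injective (trans p (sym q)))

ratio≤⇒ratio≤+1/a : ∀ a c d T N o → d * T ≤ c * N * o → d * a * T ≤ (c * a + d) * N * o
ratio≤⇒ratio≤+1/a a c d T N o dT≤cNo = begin
  d * a * T           ≡⟨ reorderˡ a d T ⟩
  a * (d * T)         ≤⟨ *-monoʳ-≤ a dT≤cNo ⟩
  a * (c * N * o)     ≤⟨ m≤m+n _ (d * N * o) ⟩
  a * (c * N * o) + d * N * o ≡⟨ reorderʳ a c d N o ⟩
  (c * a + d) * N * o ∎
  where
  open ≤-Reasoning
  reorderˡ : ∀ a d T → d * a * T ≡ a * (d * T)
  reorderˡ = solve-∀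
  reorderʳ : ∀ a c d N o → a * (c * N * o) + d * N * o ≡ (c * a + d) * N * o
  reorderʳ = solve-∀

arrival : Fin 8 → Fin 8
arrival r = lookup (# 0 ∷ # 4 ∷ # 1 ∷ # 5 ∷ # 3 ∷ # 7 ∷ # 2 ∷ # 6 ∷ []) r

arrival⁻¹ : Fin 8 → Fin 8
arrival⁻¹ s = lookup (# 0 ∷ # 2 ∷ # 6 ∷ # 4 ∷ # 1 ∷ # 3 ∷ # 7 ∷ # 5 ∷ []) s

next : Fin 8 → Fin 8
next s = lookup (# 1 ∷ # 2 ∷ # 3 ∷ # 4 ∷ # 5 ∷ # 6 ∷ # 7 ∷ # 0 ∷ []) s

cycle16 : Graph 8 8
cycle16 r s = does (s ≟ arrival r) ∨ does (s ≟ next (arrival r))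

cycle16-twoRegular : TwoRegular cycle16
cycle16-twoRegular = from-yes (all? λ r → degReq cycle16 r ℕ.≟ 2) ,
                     from-yes (all? λ s → degSrv cycle16 s ℕ.≟ 2)

cycle16-maxMatchingSize : IsMaxMatchingSize cycle16 8
cycle16-maxMatchingSize = perfectMatching⇒maxMatchingSize cycle16 arrival
  (from-yes (all? λ r → cycle16 r (arrival r) Bool.≟ true))
  (λ {r} {r'} eq → trans (sym (arrival⁻¹∘arrival r))
                         (trans (cong arrival⁻¹ eq) (arrival⁻¹∘arrival r')))
  where
  arrival⁻¹∘arrival : ∀ r → arrival⁻¹ (arrival r) ≡ r
  arrival⁻¹∘arrival = from-yes (all? λ r → arrival⁻¹ (arrival r) ≟ r)

cycle16-ranking : 144 * rankingTotal cycle16 ≡ 119 * numOrders 8 * 8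
cycle16-ranking = refl

lemma3p7 : (k : ℕ) → Σ ℕ λ m → Σ ℕ λ n → Σ (Graph m n) λ G → Σ ℕ λ opt →
    TwoRegular G × IsMaxMatchingSize G opt × 0 < opt ×
    144 * suc k * rankingTotal G ≤ (119 * suc k + 144) * numOrders n * opt
lemma3p7 k =
  8 , 8 , cycle16 , 8 , cycle16-twoRegular , cycle16-maxMatchingSize , s≤s z≤n ,
  ratio≤⇒ratio≤+1/a (suc k) 119 144 (rankingTotal cycle16) (numOrders 8) 8
                   (≤-reflexive cycle16-ranking)
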